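{- Let $G$ be a graph with chromatic number at least 3, and let $2k+1$ be the length of a shortest odd cycle of $G$. Then for every $n$, $2^n-\mathrm{vex}(n,G)\le \sum_{i=0}^{\lfloor kn/(2k+1)\rfloor}\binom{n}{i}$.
   Context: The Kneser cube $Kn_n$ is the graph with vertex set $2^{[n]}=\{F: F\subseteq\{1,\dots,n\}\}$ in which two distinct vertices $F,F'$ are adjacent if and only if $F\cap F'=\emptyset$. For a graph $G$, $\mathrm{vex}(n,G)$ is the maximum size of a family $\mathcal{F}\subseteq 2^{[n]}$ such that the induced subgraph $Kn_n[\mathcal{F}]$ contains no subgraph isomorphic to $G$. -}

module Defs where

open import Level using (0ℓ)
open import Data.Nat using (ℕ; zero; suc; _+_; _*_; _∸_; _^_; _≤_; _<_)
open import Data.Nat.DivMod using (_/_)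
open import Data.Nat.Combinatorics using (_C_)
open import Data.List using (List; map; upTo; length)
open import Data.Nat.ListAction using (sum)
open import Data.List.Membership.Propositional using (_∈_)
open import Data.List.Relation.Unary.Unique.Propositional using (Unique)
open import Data.Fin using (Fin; toℕ)
open import Data.Fin.Subset using (Subset; _∩_; Empty)
open import Data.Product using (Σ; ∃; _×_)
open import Relation.Nullary using (¬_)
open import Relation.Binary.PropositionalEquality using (_≡_; _≢_)

record Graph : Set₁ where
  field
    m     : ℕ
    Adj   : Fin m → Fin m → Set
    sym   : ∀ {u v} → Adj u v → Adj v u
    irrefl : ∀ {u} → ¬ Adj u u
open Graph public

-- Proper k-colouring; chromatic number ≥ 3  ⇔  not 2-colourable.
Colorable : ℕ → Graph → Set
Colorable k G = Σ (Fin (m G) → Fin k) λ c → ∀ u v → Adj G u v → c u ≢ c v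

HasCycle : Graph → ℕ → Set
HasCycle G L = 3 ≤ L × Σ (Fin L → Fin (m G)) λ v →
    (∀ i j → v i ≡ v j → i ≡ j)
  × (∀ i j → toℕ j ≡ suc (toℕ i) → Adj G (v i) (v j))
  × (∀ i j → suc (toℕ i) ≡ L → toℕ j ≡ 0 → Adj G (v i) (v j))

-- The shortest odd cycle of G has length 2k+1.
OddGirth : Graph → ℕ → Set
OddGirth G k = HasCycle G (suc (2 * k)) × (∀ j → j < k → ¬ HasCycle G (suc (2 * j)))

-- Adjacency in the Kneser cube Kn_n: distinct and disjoint.
KnAdj : ∀ {n} → Subset n → Subset n → Set
KnAdj F F' = F ≢ F' × Empty (F ∩ F')

ContainsCopy : ∀ {n} → List (Subset n) → Graph → Set
ContainsCopy {n} 𝓕 G = Σ (Fin (m G) → Subset n) λ f →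
    (∀ u → f u ∈ 𝓕)
  × (∀ u v → f u ≡ f v → u ≡ v)
  × (∀ u v → Adj G u v → KnAdj (f u) (f v))

-- 𝓕 ⊆ 2^[n] (given as a duplicate-free list, |𝓕| = length) is G-free.
GFreeFamily : (n : ℕ) → Graph → List (Subset n) → Set
GFreeFamily n G 𝓕 = Unique 𝓕 × ¬ ContainsCopy 𝓕 G

-- vex(n,G) ≥ s : some G-free family of size ≥ s exists (vex is the maximum).
VexAtLeast : ℕ → Graph → ℕ → Set
VexAtLeast n G s = ∃ λ 𝓕 → GFreeFamily n G 𝓕 × s ≤ length 𝓕

binomSum : ℕ → ℕ → ℕ
binomSum n t = sum (map (n C_) (upTo (suc t)))

{-# OPTIONS --safe #-}
module Submission where

-- Let 𝓕 consist of the sets of size greater than t = ⌊kn/(2k+1)⌋; the sets it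
-- misses number Σ_{i≤t} C(n,i). A copy of G in Kn_n[𝓕] contains the image
-- A_0, …, A_{2k} of a shortest odd cycle, with cyclically consecutive A_i
-- disjoint. An element of [n] lies in no two consecutive A_i, hence in at most
-- k of them, so Σ|A_i| ≤ kn; but Σ|A_i| ≥ (2k+1)(t+1) > kn.

open import Defs
open import Data.Nat using (ℕ; suc; _*_; _∸_; _^_; _≤_)
open import Data.Nat.DivMod using (_/_)
open import Relation.Nullary using (¬_)

open import Data.Empty using (⊥-elim)
open import Data.Fin using (Fin; zero; toℕ; fromℕ<)
open import Data.Fin.Properties using (toℕ-fromℕ<)
open import Data.Fin.Subset using (Subset; Empty; _∩_; ∣_∣; Side; inside; outside)
open import Data.Fin.Subset.Properties using (∣p∣≤n; drop-∷-Empty)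
open import Data.List using (List; []; _∷_; [_]; _++_; map; length; applyUpTo)
open import Data.List.Membership.Propositional using (_∈_)
open import Data.List.Membership.Propositional.Properties using (∈-++⁻; ∈-map⁻)
open import Data.List.Properties using (length-++; length-map; applyUpTo-∷ʳ; map-upTo)
open import Data.List.Relation.Unary.All using ([])
open import Data.List.Relation.Unary.Unique.Propositional using (Unique; []; _∷_)
import Data.List.Relation.Unary.Unique.Propositional.Properties as Unique
open import Data.Nat using (zero; _+_; _<_; z≤n; s≤s; z<s; s<s; pred; NonZero)
open import Data.Nat.Combinatorics using (_C_; nCk+nC[k+1]≡[n+1]C[k+1])
open import Data.Nat.DivMod using (_%_; m≡m%n+[m/n]*n; m%n<n; m<n⇒m%n≡m)
open import Data.Nat.ListAction using (sum)
open import Data.Nat.ListAction.Properties using (sum-++)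
open import Data.Nat.Properties
open import Algebra.Properties.CommutativeSemigroup +-commutativeSemigroup using (interchange)
open import Data.Product using (Σ; _×_; _,_; proj₂)
open import Data.Sum using (inj₁; inj₂)
open import Data.Vec using ([]; _∷_; head; tail; here)
open import Data.Vec.Properties using (∷-injectiveʳ)
open import Function using (_∘_)
open import Relation.Binary.PropositionalEquality as ≡ using (_≡_; refl; trans; cong; cong₂; module ≡-Reasoning)

[m+n]+[o+p]≡[m+p]+[n+o] : ∀ m n o p → (m + n) + (o + p) ≡ (m + p) + (n + o)
[m+n]+[o+p]≡[m+p]+[n+o] m n o p = trans (cong (m + n +_) (+-comm o p)) (interchange m n p o)

m<[1+m/n]*n : ∀ m n .{{_ : NonZero n}} → m < suc (m / n) * n
m<[1+m/n]*n m n = begin-strict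
  m                  ≡⟨ m≡m%n+[m/n]*n m n ⟩
  m % n + m / n * n  <⟨ +-monoˡ-< (m / n * n) (m%n<n m n) ⟩
  n + m / n * n      ∎
  where open ≤-Reasoning

sumUpTo : (ℕ → ℕ) → ℕ → ℕ
sumUpTo f m = sum (applyUpTo f m)

sumUpTo-cong : ∀ {f g} m → (∀ i → f i ≡ g i) → sumUpTo f m ≡ sumUpTo g m
sumUpTo-cong zero    f≗g = refl
sumUpTo-cong (suc m) f≗g = cong₂ _+_ (f≗g 0) (sumUpTo-cong m (f≗g ∘ suc))

sumUpTo-+ : ∀ f g m → sumUpTo (λ i → f i + g i) m ≡ sumUpTo f m + sumUpTo g m
sumUpTo-+ f g zero    = refl
sumUpTo-+ f g (suc m) = trans (cong (f 0 + g 0 +_) (sumUpTo-+ (f ∘ suc) (g ∘ suc) m))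
                              (interchange (f 0) (g 0) (sumUpTo (f ∘ suc) m) (sumUpTo (g ∘ suc) m))

sumUpTo-suc : ∀ f m → sumUpTo f (suc m) ≡ sumUpTo f m + f m
sumUpTo-suc f m = begin
  sum (applyUpTo f (suc m))         ≡⟨ cong sum (applyUpTo-∷ʳ f m) ⟨
  sum (applyUpTo f m ++ [ f m ])    ≡⟨ sum-++ (applyUpTo f m) [ f m ] ⟩
  sumUpTo f m + (f m + 0)           ≡⟨ cong (sumUpTo f m +_) (+-identityʳ (f m)) ⟩
  sumUpTo f m + f m                 ∎
  where open ≡-Reasoning

sumUpTo-const : ∀ m c → sumUpTo (λ _ → c) m ≡ m * c
sumUpTo-const zero    c = refl
sumUpTo-const (suc m) c = cong (c +_) (sumUpTo-const m c)

sumUpTo-mono-≤ : ∀ {f g} m → (∀ i → i < m → f i ≤ g i) → sumUpTo f m ≤ sumUpTo g m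
sumUpTo-mono-≤ zero    f≤g = z≤n
sumUpTo-mono-≤ (suc m) f≤g = +-mono-≤ (f≤g 0 z<s) (sumUpTo-mono-≤ m (λ i i<m → f≤g (suc i) (s<s i<m)))

sumUpTo-≤-* : ∀ {f} m c → (∀ i → i < m → f i ≤ c) → sumUpTo f m ≤ m * c
sumUpTo-≤-* m c f≤c = ≤-trans (sumUpTo-mono-≤ m f≤c) (≤-reflexive (sumUpTo-const m c))

*-≤-sumUpTo : ∀ {f} m c → (∀ i → c ≤ f i) → m * c ≤ sumUpTo f m
*-≤-sumUpTo m c c≤f = ≤-trans (≤-reflexive (≡.sym (sumUpTo-const m c))) (sumUpTo-mono-≤ m (λ i _ → c≤f i))

-- The closed walk a 0, a 1, …, a D, a 0; the values a i for i > D play no role.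
record ClosedWalk {A : Set} (R : A → A → Set) (D : ℕ) (a : ℕ → A) : Set where
  constructor closedWalk
  field
    step    : ∀ i → i < D → R (a i) (a (suc i))
    closing : R (a D) (a 0)

ClosedWalk-map : ∀ {A B : Set} {R : A → A → Set} {S : B → B → Set} {D a} (f : A → B) →
                 (∀ {x y} → R x y → S (f x) (f y)) → ClosedWalk R D a → ClosedWalk S D (f ∘ a)
ClosedWalk-map f f-hom (closedWalk step closing) = closedWalk (λ i i<D → f-hom (step i i<D)) (f-hom closing)

-- Summing a i + a (i+1) ≤ 1 over the D+1 edges of the walk counts every term twice.
2*sumUpTo-closed-walk≤length : ∀ D {a} → ClosedWalk (λ x y → x + y ≤ 1) D a → 2 * sumUpTo a (suc D) ≤ suc D
2*sumUpTo-closed-walk≤length D {a} (closedWalk step closing) = begin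
  2 * S
    ≡⟨ cong (S +_) (+-identityʳ S) ⟩
  S + S
    ≡⟨ cong (_+ S) (sumUpTo-suc a D) ⟩
  (sumUpTo a D + a D) + (a 0 + sumUpTo (a ∘ suc) D)
    ≡⟨ [m+n]+[o+p]≡[m+p]+[n+o] (sumUpTo a D) (a D) (a 0) (sumUpTo (a ∘ suc) D) ⟩
  (sumUpTo a D + sumUpTo (a ∘ suc) D) + (a D + a 0)
    ≡⟨ cong (_+ (a D + a 0)) (sumUpTo-+ a (a ∘ suc) D) ⟨
  sumUpTo (λ i → a i + a (suc i)) D + (a D + a 0)
    ≤⟨ +-mono-≤ (sumUpTo-≤-* D 1 step) closing ⟩
  D * 1 + 1
    ≡⟨ cong (_+ 1) (*-identityʳ D) ⟩
  D + 1
    ≡⟨ +-comm D 1 ⟩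
  suc D ∎
  where
  open ≤-Reasoning
  S : ℕ
  S = sumUpTo a (suc D)

sumUpTo-odd-closed-walk≤k : ∀ k {a} → ClosedWalk (λ x y → x + y ≤ 1) (2 * k) a → sumUpTo a (suc (2 * k)) ≤ k
sumUpTo-odd-closed-walk≤k k {a} walk = m<1+n⇒m≤n (*-cancelˡ-< 2 (sumUpTo a (suc (2 * k))) (suc k) (begin-strict
  2 * sumUpTo a (suc (2 * k))  <⟨ s≤s (2*sumUpTo-closed-walk≤length (2 * k) {a} walk) ⟩
  suc (suc (2 * k))            ≡⟨ *-suc 2 k ⟨
  2 * suc k                    ∎))
  where open ≤-Reasoning

Disjoint : ∀ {n} → Subset n → Subset n → Set
Disjoint p q = Empty (p ∩ q)

indicator : Side → ℕ
indicator outside = 0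
indicator inside  = 1

∣p∣≡indicator[head]+∣tail∣ : ∀ {n} (p : Subset (suc n)) → ∣ p ∣ ≡ indicator (head p) + ∣ tail p ∣
∣p∣≡indicator[head]+∣tail∣ (outside ∷ p) = refl
∣p∣≡indicator[head]+∣tail∣ (inside  ∷ p) = refl

Disjoint-head : ∀ {n} {p q : Subset (suc n)} → Disjoint p q → indicator (head p) + indicator (head q) ≤ 1
Disjoint-head {p = outside ∷ _} {outside ∷ _} _    = z≤n
Disjoint-head {p = outside ∷ _} {inside  ∷ _} _    = ≤-refl
Disjoint-head {p = inside  ∷ _} {outside ∷ _} _    = ≤-refl
Disjoint-head {p = inside  ∷ _} {inside  ∷ _} p∩q∅ = ⊥-elim (p∩q∅ (zero , here))

Disjoint-tail : ∀ {n} {p q : Subset (suc n)} → Disjoint p q → Disjoint (tail p) (tail q)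
Disjoint-tail {p = _ ∷ _} {_ ∷ _} = drop-∷-Empty

sumUpTo-size-odd-closed-walk≤k*n : ∀ k n {A : ℕ → Subset n} → ClosedWalk Disjoint (2 * k) A →
                                 sumUpTo (∣_∣ ∘ A) (suc (2 * k)) ≤ k * n
sumUpTo-size-odd-closed-walk≤k*n k zero {A} _ = begin
  sumUpTo (∣_∣ ∘ A) (suc (2 * k))  ≤⟨ sumUpTo-≤-* (suc (2 * k)) 0 (λ i _ → ∣p∣≤n (A i)) ⟩
  suc (2 * k) * 0                  ≡⟨ *-zeroʳ (suc (2 * k)) ⟩
  0                                ≡⟨ *-zeroʳ k ⟨
  k * 0                            ∎
  where open ≤-Reasoning
sumUpTo-size-odd-closed-walk≤k*n k (suc n) {A} walk = begin
  sumUpTo (∣_∣ ∘ A) L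
    ≡⟨ sumUpTo-cong L (∣p∣≡indicator[head]+∣tail∣ ∘ A) ⟩
  sumUpTo (λ i → indicator (head (A i)) + ∣ tail (A i) ∣) L
    ≡⟨ sumUpTo-+ (indicator ∘ head ∘ A) (∣_∣ ∘ tail ∘ A) L ⟩
  sumUpTo (indicator ∘ head ∘ A) L + sumUpTo (∣_∣ ∘ tail ∘ A) L
    ≤⟨ +-mono-≤ (sumUpTo-odd-closed-walk≤k k heads) (sumUpTo-size-odd-closed-walk≤k*n k n tails) ⟩
  k + k * n
    ≡⟨ *-suc k n ⟨
  k * suc n ∎
  where
  open ≤-Reasoning
  L : ℕ
  L = suc (2 * k)
  heads : ClosedWalk (λ x y → x + y ≤ 1) (2 * k) (indicator ∘ head ∘ A)
  heads = ClosedWalk-map (indicator ∘ head) Disjoint-head walk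
  tails : ClosedWalk Disjoint (2 * k) (tail ∘ A)
  tails = ClosedWalk-map tail Disjoint-tail walk

closedWalk-of-cycle : ∀ G {D} → HasCycle G (suc D) → Σ (ℕ → Fin (m G)) (ClosedWalk (Adj G) D)
closedWalk-of-cycle G {D} (_ , v , _ , edge , closing-edge) = v ∘ position , closedWalk step closing
  where
  position : ℕ → Fin (suc D)
  position i = fromℕ< (m%n<n i (suc D))
  toℕ-position : ∀ {i} → i < suc D → toℕ (position i) ≡ i
  toℕ-position {i} i<1+D = trans (toℕ-fromℕ< (m%n<n i (suc D))) (m<n⇒m%n≡m i<1+D)
  step : ∀ i → i < D → Adj G (v (position i)) (v (position (suc i)))
  step i i<D = edge (position i) (position (suc i))
    (trans (toℕ-position (s≤s i<D)) (cong suc (≡.sym (toℕ-position (m<n⇒m<1+n i<D)))))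
  closing : Adj G (v (position D)) (v (position 0))
  closing = closing-edge (position D) (position 0) (cong suc (toℕ-position (n<1+n D))) (toℕ-position z<s)

atLeast : (n s : ℕ) → List (Subset n)
atLeast zero    zero    = [] ∷ []
atLeast zero    (suc s) = []
atLeast (suc n) s       = map (outside ∷_) (atLeast n s) ++ map (inside ∷_) (atLeast n (pred s))

atLeast-unique : ∀ n s → Unique (atLeast n s)
atLeast-unique zero    zero    = [] ∷ []
atLeast-unique zero    (suc s) = []
atLeast-unique (suc n) s       = Unique.++⁺ (Unique.map⁺ ∷-injectiveʳ (atLeast-unique n s))
                                            (Unique.map⁺ ∷-injectiveʳ (atLeast-unique n (pred s)))
                                            heads-differ
  where
  heads-differ : ∀ {p} → ¬ (p ∈ map (outside ∷_) (atLeast n s) × p ∈ map (inside ∷_) (atLeast n (pred s)))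
  heads-differ (p∈outside , p∈inside) with ∈-map⁻ (outside ∷_) p∈outside | ∈-map⁻ (inside ∷_) p∈inside
  ... | _ , _ , refl | _ , _ , ()

∈-atLeast⁻ : ∀ n s {p} → p ∈ atLeast n s → s ≤ ∣ p ∣
∈-atLeast⁻ zero    zero    _ = z≤n
∈-atLeast⁻ (suc n) s       p∈ with ∈-++⁻ (map (outside ∷_) (atLeast n s)) p∈
... | inj₁ p∈outside with ∈-map⁻ (outside ∷_) p∈outside
...   | _ , q∈ , refl = ∈-atLeast⁻ n s q∈
∈-atLeast⁻ (suc n) zero    p∈ | inj₂ _ = z≤n
∈-atLeast⁻ (suc n) (suc s) p∈ | inj₂ p∈inside with ∈-map⁻ (inside ∷_) p∈inside
...   | _ , q∈ , refl = s≤s (∈-atLeast⁻ n s q∈)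

sumUpTo-C-suc : ∀ n s → sumUpTo (suc n C_) s ≡ sumUpTo (n C_) (pred s) + sumUpTo (n C_) s
sumUpTo-C-suc n zero    = refl
sumUpTo-C-suc n (suc s) = begin
  1 + sumUpTo (λ i → suc n C suc i) s          ≡⟨ cong suc (sumUpTo-cong s (≡.sym ∘ nCk+nC[k+1]≡[n+1]C[k+1] n)) ⟩
  1 + sumUpTo (λ i → n C i + n C suc i) s      ≡⟨ cong suc (sumUpTo-+ (n C_) ((n C_) ∘ suc) s) ⟩
  1 + (sumUpTo (n C_) s + sumUpTo ((n C_) ∘ suc) s) ≡⟨ +-suc (sumUpTo (n C_) s) _ ⟨
  sumUpTo (n C_) s + sumUpTo (n C_) (suc s)    ∎
  where open ≡-Reasoning

length-atLeast : ∀ n s → length (atLeast n s) + sumUpTo (n C_) s ≡ 2 ^ n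
length-atLeast zero    zero    = refl
length-atLeast zero    (suc s) = cong suc (trans (sumUpTo-const s 0) (*-zeroʳ s))
length-atLeast (suc n) s       = begin
  length (map (outside ∷_) (atLeast n s) ++ map (inside ∷_) (atLeast n (pred s))) + sumUpTo (suc n C_) s
    ≡⟨ cong₂ _+_ length-halves (sumUpTo-C-suc n s) ⟩
  (length (atLeast n s) + length (atLeast n (pred s))) + (sumUpTo (n C_) (pred s) + sumUpTo (n C_) s)
    ≡⟨ [m+n]+[o+p]≡[m+p]+[n+o] (length (atLeast n s)) _ _ (sumUpTo (n C_) s) ⟩
  (length (atLeast n s) + sumUpTo (n C_) s) + (length (atLeast n (pred s)) + sumUpTo (n C_) (pred s))
    ≡⟨ cong₂ _+_ (length-atLeast n s) (length-atLeast n (pred s)) ⟩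
  2 ^ n + 2 ^ n
    ≡⟨ cong (2 ^ n +_) (+-identityʳ (2 ^ n)) ⟨
  2 ^ suc n ∎
  where
  open ≡-Reasoning
  length-halves : length (map (outside ∷_) (atLeast n s) ++ map (inside ∷_) (atLeast n (pred s)))
                ≡ length (atLeast n s) + length (atLeast n (pred s))
  length-halves = trans (length-++ (map (outside ∷_) (atLeast n s)))
                        (cong₂ _+_ (length-map (outside ∷_) (atLeast n s)) (length-map (inside ∷_) (atLeast n (pred s))))

atLeast-avoids-odd-closed-walks : ∀ G k {n s w} → ClosedWalk (Adj G) (2 * k) w → k * n < s * suc (2 * k) →
                                  ¬ ContainsCopy (atLeast n s) G
atLeast-avoids-odd-closed-walks G k {n} {s} {w} walk kn<s[2k+1] (f , f∈ , _ , f-hom) = <⇒≱ kn<s[2k+1] (begin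
  s * suc (2 * k)                      ≡⟨ *-comm s (suc (2 * k)) ⟩
  suc (2 * k) * s                      ≤⟨ *-≤-sumUpTo (suc (2 * k)) s (λ i → ∈-atLeast⁻ n s (f∈ (w i))) ⟩
  sumUpTo (∣_∣ ∘ f ∘ w) (suc (2 * k))  ≤⟨ sumUpTo-size-odd-closed-walk≤k*n k n disjoint-walk ⟩
  k * n                                ∎)
  where
  open ≤-Reasoning
  disjoint-walk : ClosedWalk Disjoint (2 * k) (f ∘ w)
  disjoint-walk = ClosedWalk-map f (λ {u} {v} uv → proj₂ (f-hom u v uv)) walk

proposition3 : (G : Graph) (k : ℕ) → ¬ Colorable 2 G → OddGirth G k → (n : ℕ) →
    VexAtLeast n G (2 ^ n ∸ binomSum n ((k * n) / suc (2 * k)))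
proposition3 G k _ (odd-cycle , _) n =
  atLeast n (suc t) , (atLeast-unique n (suc t) , G-free) , ≤-reflexive size
  where
  t : ℕ
  t = (k * n) / suc (2 * k)
  kn<[1+t][2k+1] : k * n < suc t * suc (2 * k)
  kn<[1+t][2k+1] = m<[1+m/n]*n (k * n) (suc (2 * k))
  G-free : ¬ ContainsCopy (atLeast n (suc t)) G
  G-free = atLeast-avoids-odd-closed-walks G k (proj₂ (closedWalk-of-cycle G odd-cycle)) kn<[1+t][2k+1]
  size : 2 ^ n ∸ binomSum n t ≡ length (atLeast n (suc t))
  size = begin
    2 ^ n ∸ binomSum n t
      ≡⟨ cong₂ _∸_ (≡.sym (length-atLeast n (suc t))) (cong sum (map-upTo (n C_) (suc t))) ⟩
    length (atLeast n (suc t)) + sumUpTo (n C_) (suc t) ∸ sumUpTo (n C_) (suc t)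
      ≡⟨ m+n∸n≡m (length (atLeast n (suc t))) (sumUpTo (n C_) (suc t)) ⟩
    length (atLeast n (suc t)) ∎
    where open ≡-Reasoning
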